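{- Let $n\in\mathbb{N}$ and let $x,k$ be integers. (1) If $x$ is odd, $4\le x\le 2n$ and $3\le k\le x-2$, then $$\hat P_{2n+2}(x,k)=\sum_{i=0}^{\lfloor k/2\rfloor-1}P_{n-i}\!\left(\tfrac{x-2i-1}{2},k\right)+\sum_{j=0}^{k}P_{\frac{2n-k+1}{2}}\!\left(\tfrac{x-k}{2},j\right),$$ where the second sum is interpreted as $0$ when $k$ is even. (2) If $x$ is even, $4\le x\le 2n-1$ and $3\le k\le x-2$, then $$\hat P_{2n+1}(x,k)=\sum_{i=0}^{\lfloor (k-1)/2\rfloor}P_{n-i}\!\left(\tfrac{x-2i}{2},k\right)+\sum_{j=0}^{k}P_{\frac{2n-k}{2}}\!\left(\tfrac{x-k}{2},j\right),$$ where the second sum is interpreted as $0$ when $k$ is odd.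
   Context: For a binary string $X$, let $X_l$ be the multiset of lengths of the maximal blocks of consecutive zeros of $X$. For integers $m\ge 0$ and $y,j\ge 0$, $B_m^{y,j}$ denotes the set of binary strings of length $m$ with exactly $y$ zeros and longest block of consecutive zeros of length exactly $j$ (the all-ones string, including the empty string, lies in $B_m^{0,0}$), and $P_{m+1}(y,j)$ denotes the number of distinct multisets $X_l$ with $X\in B_m^{y,j}$ (the number of equivalence classes of $B_m^{y,j}$ under $X\sim Y\iff X_l=Y_l$). Similarly $\hat B_m^{y,j}$ denotes the set of palindromic binary strings (equal to their reversal) of length $m$ with exactly $y$ zeros and longest block of zeros of length exactly $j$, and $\hat P_{m+1}(y,j)$ denotes the number of distinct multisets $X_l$ with $X\in\hat B_m^{y,j}$ (these correspond to palindromic partitions of $m+1$). -}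

module Defs where

open import Data.Bool using (Bool; true; false; if_then_else_)
open import Data.Nat using (ℕ; zero; suc; _+_; _⊔_; _≟_; _≤_)
open import Data.Nat.Properties using (≤-decTotalOrder)
open import Data.List using (List; []; _∷_; map; filter; deduplicate; length; reverse; foldr; _++_)
import Data.List.Properties as LP
import Data.Bool.Properties as BP
open import Data.Product using (_×_; _,_)
open import Relation.Binary.PropositionalEquality using (_≡_)
open import Relation.Nullary.Decidable using (_×-dec_; Dec)
import Data.List.Sort.InsertionSort.Base as IS

-- Binary strings: true = 1, false = 0.

allStrings : ℕ → List (List Bool)
allStrings zero = [] ∷ []
allStrings (suc m) = map (false ∷_) (allStrings m) ++ map (true ∷_) (allStrings m)

-- lengths of the maximal blocks of consecutive zeros, in order of occurrence;
-- the first argument is the length of the current (still open) run of zeros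
blocksAux : ℕ → List Bool → List ℕ
blocksAux zero [] = []
blocksAux (suc c) [] = suc c ∷ []
blocksAux c (false ∷ xs) = blocksAux (suc c) xs
blocksAux zero (true ∷ xs) = blocksAux zero xs
blocksAux (suc c) (true ∷ xs) = suc c ∷ blocksAux zero xs

zeroBlocks : List Bool → List ℕ
zeroBlocks = blocksAux zero

-- X_l : the multiset of block lengths, represented canonically as a sorted list
multisetOf : List ℕ → List ℕ
multisetOf = IS.sort ≤-decTotalOrder

blockMultiset : List Bool → List ℕ
blockMultiset X = multisetOf (zeroBlocks X)

numZeros : List Bool → ℕ
numZeros [] = 0
numZeros (false ∷ xs) = suc (numZeros xs)
numZeros (true ∷ xs) = numZeros xs

longestZeroBlock : List Bool → ℕ
longestZeroBlock X = foldr _⊔_ 0 (zeroBlocks X)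

-- membership predicate of B^{y,j} (length handled by allStrings)
inB? : (y j : ℕ) (X : List Bool) → Dec ((numZeros X ≡ y) × (longestZeroBlock X ≡ j))
inB? y j X = (numZeros X ≟ y) ×-dec (longestZeroBlock X ≟ j)

isPalindrome? : (X : List Bool) → Dec (X ≡ reverse X)
isPalindrome? X = LP.≡-dec BP._≟_ X (reverse X)

numDistinct : List (List ℕ) → ℕ
numDistinct L = length (deduplicate (LP.≡-dec _≟_) L)

B : (m y j : ℕ) → List (List Bool)
B m y j = filter (inB? y j) (allStrings m)

Bhat : (m y j : ℕ) → List (List Bool)
Bhat m y j = filter isPalindrome? (B m y j)

-- P_{m+1}(y,j) = number of distinct X_l, X ∈ B_m^{y,j}.
-- P N y j uses strings of length N ∸ 1 (the case N = 0 never occurs in the theorem).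
P : (N y j : ℕ) → ℕ
P zero y j = numDistinct (map blockMultiset (B 0 y j))
P (suc m) y j = numDistinct (map blockMultiset (B m y j))

Phat : (N y j : ℕ) → ℕ
Phat zero y j = numDistinct (map blockMultiset (Bhat 0 y j))
Phat (suc m) y j = numDistinct (map blockMultiset (Bhat m y j))

sumTo : ℕ → (ℕ → ℕ) → ℕ
sumTo zero f = 0
sumTo (suc n) f = sumTo n f + f n

module Submission where

-- A palindrome X of length e + 2n (e ≤ 1) with e + 2a zeros that contains a one
-- splits uniquely as X = Yʳ 1 0ᶜ 1 Y, the centre c = e + 2i being the central run of
-- zeros and Y a string of length n - i - 1 with a - i zeros (palindrome-centred).
-- The zero-block multiset of X is then {c} ⊎ 2·(blocks of Y) (blockMultiset-construct),
-- from which c and the multiset of Y can be recovered (mirror-injective, proved by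
-- counting multiplicities: a number u + 2m with u ≤ 1 determines u and m).  Hence the
-- classes of palindromes with longest block k are in bijection with the disjoint union
-- of the classes of halves Y, grouped by the centre: either c < k, and then Y has
-- longest block k, or c = k (possible only when k ≡ e mod 2), and then Y has any longest
-- block j ≤ k.

open import Defs
open import Data.Bool using (Bool; true; false; if_then_else_)
open import Data.Nat using (ℕ; zero; suc; _+_; _*_; _∸_; _≤_; _<_; _⊔_; _%_; ⌊_/2⌋; ⌈_/2⌉; _≡ᵇ_; _≟_; z≤n; s≤s)
open import Data.Nat.Properties
open import Data.Nat.DivMod using ([m+kn]%n≡m%n; m*n%n≡0)
open import Data.Nat.ListAction using (sum)
open import Data.Nat.ListAction.Properties using (sum-++; sum-↭)
open import Data.Nat.Tactic.RingSolver using (solve-∀)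
open import Data.List using (List; []; _∷_; _++_; reverse; replicate; length; map; filter; foldr; deduplicate; take; drop)
open import Data.List.Properties using (length-++; filter-++; filter-accept; filter-none; map-++; map-∘; map-cong)
import Data.List.Properties as List
open import Data.List.Membership.Propositional using (_∈_; _∉_)
open import Data.List.Membership.Propositional.Properties
  using (∈-++⁺ˡ; ∈-++⁺ʳ; ∈-++⁻; ∈-map⁺; ∈-map⁻; ∈-filter⁺; ∈-filter⁻; deduplicate-∈⇔)
open import Data.List.Membership.Propositional.Properties.WithK using (unique∧set⇒bag)
open import Data.List.Relation.Binary.BagAndSetEquality using (_∼[_]_; set; ∼bag⇒↭)
import Data.List.Relation.Binary.BagAndSetEquality as Set
open import Data.List.Relation.Binary.Permutation.Propositional using (_↭_; ↭⇒↭ₛ; module PermutationReasoning)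
import Data.List.Relation.Binary.Permutation.Propositional.Properties as Perm
open import Data.List.Relation.Binary.Permutation.Setoid.Properties using (foldr-commMonoid)
import Data.List.Relation.Unary.All as All
open import Data.List.Relation.Unary.AllPairs using ([]; _∷_)
open import Data.List.Relation.Unary.Any using (here; there)
open import Data.List.Relation.Unary.Linked as Linked using (Linked; [-])
open import Data.List.Relation.Unary.Linked.Properties using (Linked⇒All)
open import Data.List.Relation.Unary.Unique.Propositional using (Unique)
import Data.List.Relation.Unary.Unique.Propositional.Properties as Unique
open import Data.List.Relation.Unary.Unique.DecPropositional.Properties (List.≡-dec _≟_) using (deduplicate-!)
import Data.List.Sort.InsertionSort.Properties ≤-decTotalOrder as InsertionSort
open import Data.Product using (_×_; _,_; ∃; ∃₂; proj₁; proj₂)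
open import Data.Sum using (inj₁; inj₂)
open import Function using (_∘_)
open import Function.Bundles using (_⇔_; mk⇔; Equivalence)
open import Relation.Binary.Definitions using (tri<; tri≈; tri>)
open import Relation.Binary.PropositionalEquality
open import Relation.Nullary using (contradiction; yes; no)

distinct : List (List ℕ) → List (List ℕ)
distinct = deduplicate (List.≡-dec _≟_)

distinct-∼ : (L : List (List ℕ)) → L ∼[ set ] distinct L
distinct-∼ L = deduplicate-∈⇔ (List.≡-dec _≟_)

numDistinct-unique : ∀ {L U} → Unique U → L ∼[ set ] U → numDistinct L ≡ length U
numDistinct-unique {L} u L∼U = Perm.↭-length (∼bag⇒↭ (unique∧set⇒bag (deduplicate-! L) u
  (mk⇔ (λ z∈ → Equivalence.to L∼U (Equivalence.from (distinct-∼ L) z∈))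
       (λ z∈ → Equivalence.to (distinct-∼ L) (Equivalence.from L∼U z∈)))))

numDistinct-cong : ∀ {L L'} → L ∼[ set ] L' → numDistinct L ≡ numDistinct L'
numDistinct-cong {L} {L'} L∼L' = numDistinct-unique (deduplicate-! L')
  (mk⇔ (λ z∈ → Equivalence.to (distinct-∼ L') (Equivalence.to L∼L' z∈))
       (λ z∈ → Equivalence.from L∼L' (Equivalence.from (distinct-∼ L') z∈)))

numDistinct-++ : ∀ L L' → (∀ {z} → z ∈ L → z ∉ L') →
  numDistinct (L ++ L') ≡ numDistinct L + numDistinct L'
numDistinct-++ L L' disjoint = trans
  (numDistinct-unique (Unique.++⁺ (deduplicate-! L) (deduplicate-! L')
      (λ (p , q) → disjoint (Equivalence.from (distinct-∼ L) p) (Equivalence.from (distinct-∼ L') q)))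
    (Set.++-cong (distinct-∼ L) (distinct-∼ L')))
  (length-++ (distinct L))

unique-map : ∀ {A B : Set} (f : A → B) {xs : List A} →
  (∀ {x y} → x ∈ xs → y ∈ xs → f x ≡ f y → x ≡ y) → Unique xs → Unique (map f xs)
unique-map f injective [] = []
unique-map f {x ∷ xs} injective (x∉xs ∷ u) =
  All.tabulate fx∉ ∷ unique-map f (λ p q → injective (there p) (there q)) u
  where
  fx∉ : ∀ {w} → w ∈ map f xs → f x ≢ w
  fx∉ w∈ fx≡w with ∈-map⁻ f w∈
  ... | y , y∈xs , refl = All.lookup x∉xs y∈xs (injective (here refl) (there y∈xs) fx≡w)

numDistinct-map : ∀ (f : List ℕ → List ℕ) L → (∀ {x y} → x ∈ L → y ∈ L → f x ≡ f y → x ≡ y) →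
  numDistinct (map f L) ≡ numDistinct L
numDistinct-map f L injective = trans
  (numDistinct-unique
    (unique-map f (λ p q → injective (Equivalence.from (distinct-∼ L) p) (Equivalence.from (distinct-∼ L) q))
      (deduplicate-! L))
    (Set.map-cong (λ _ → refl) (distinct-∼ L)))
  (List.length-map f (distinct L))

Sorted : List ℕ → Set
Sorted = Linked _≤_

occ : ℕ → List ℕ → ℕ
occ a xs = length (filter (_≟ a) xs)

occ-++ : ∀ a xs ys → occ a (xs ++ ys) ≡ occ a xs + occ a ys
occ-++ a xs ys = trans (cong length (filter-++ (_≟ a) xs ys)) (length-++ (filter (_≟ a) xs))

occ-↭ : ∀ a {xs ys} → xs ↭ ys → occ a xs ≡ occ a ys
occ-↭ a xs↭ys = Perm.↭-length (Perm.filter-↭ (_≟ a) xs↭ys)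

occ-self : ∀ x xs → occ x (x ∷ xs) ≡ suc (occ x xs)
occ-self x xs = cong length (filter-accept (_≟ x) refl)

-- In a sorted list all entries are at least the head, so smaller values do not occur.
occ-below : ∀ {x y ys} → x < y → Sorted (y ∷ ys) → occ x (y ∷ ys) ≡ 0
occ-below x<y sorted = cong length (filter-none (_≟ _)
  (All.map (λ y≤z z≡x → <⇒≱ x<y (subst (_ ≤_) z≡x y≤z)) (Linked⇒All ≤-trans ≤-refl sorted)))

sorted-unique : ∀ {xs ys} → Sorted xs → Sorted ys → (∀ a → occ a xs ≡ occ a ys) → xs ≡ ys
sorted-unique {[]} {[]} _ _ _ = refl
sorted-unique {[]} {y ∷ ys} _ _ same = contradiction (trans (same y) (occ-self y ys)) 0≢1+n
sorted-unique {x ∷ xs} {[]} _ _ same = contradiction (trans (sym (same x)) (occ-self x xs)) 0≢1+n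
sorted-unique {x ∷ xs} {y ∷ ys} sx sy same with <-cmp x y
... | tri< x<y _ _ = contradiction (trans (sym (occ-self x xs)) (trans (same x) (occ-below x<y sy))) 1+n≢0
... | tri> _ _ y<x = contradiction (trans (sym (occ-self y ys)) (trans (sym (same y)) (occ-below y<x sx))) 1+n≢0
... | tri≈ _ refl _ = cong (x ∷_) (sorted-unique (Linked.tail sx) (Linked.tail sy) λ a →
  +-cancelˡ-≡ (occ a (x ∷ [])) _ _ (trans (sym (occ-++ a (x ∷ []) xs)) (trans (same a) (occ-++ a (x ∷ []) ys))))

sorted-↭ : ∀ {xs ys} → Sorted xs → Sorted ys → xs ↭ ys → xs ≡ ys
sorted-↭ sx sy xs↭ys = sorted-unique sx sy (λ a → occ-↭ a xs↭ys)

multisetOf-sorted : ∀ xs → Sorted (multisetOf xs)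
multisetOf-sorted = InsertionSort.sort-↗

multisetOf-↭ : ∀ xs → multisetOf xs ↭ xs
multisetOf-↭ = InsertionSort.sort-↭

-- block c: the block list of a run of c zeros, i.e. [] for c = 0 and [c] otherwise.
block : ℕ → List ℕ
block c = blocksAux c []

block-sorted : ∀ c → Sorted (block c)
block-sorted zero = Linked.[]
block-sorted (suc c) = [-]

block-injective : ∀ {c c'} → block c ≡ block c' → c ≡ c'
block-injective {zero} {zero} _ = refl
block-injective {suc c} {suc c'} e = List.∷-injectiveˡ e

occ-block : ∀ a c → occ a (block c) ≤ 1
occ-block a zero = z≤n
occ-block a (suc c) = List.length-filter (_≟ a) (suc c ∷ [])

-- The multiset of a palindrome with a central block of c zeros and halves of multiset M.
mirror : ℕ → List ℕ → List ℕ
mirror c M = multisetOf (block c ++ M ++ M)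

occ-mirror : ∀ a c M → occ a (mirror c M) ≡ occ a (block c) + 2 * occ a M
occ-mirror a c M = begin
  occ a (mirror c M)                          ≡⟨ occ-↭ a (multisetOf-↭ (block c ++ M ++ M)) ⟩
  occ a (block c ++ M ++ M)                   ≡⟨ occ-++ a (block c) (M ++ M) ⟩
  occ a (block c) + occ a (M ++ M)            ≡⟨ cong (occ a (block c) +_) (occ-++ a M M) ⟩
  occ a (block c) + (occ a M + occ a M)       ≡⟨ cong (λ m → occ a (block c) + (occ a M + m)) (sym (+-identityʳ (occ a M))) ⟩
  occ a (block c) + 2 * occ a M               ∎
  where open ≡-Reasoning

parity-unique : ∀ {u u' m m'} → u ≤ 1 → u' ≤ 1 → u + 2 * m ≡ u' + 2 * m' → u ≡ u' × m ≡ m'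
parity-unique {zero} {zero} {m} {m'} _ _ e = refl , *-cancelˡ-≡ m m' 2 e
parity-unique {suc zero} {suc zero} {m} {m'} _ _ e = refl , *-cancelˡ-≡ m m' 2 (suc-injective e)
parity-unique {zero} {suc zero} {m} {m'} _ _ e = contradiction e (even≢odd m m')
parity-unique {suc zero} {zero} {m} {m'} _ _ e = contradiction (sym e) (even≢odd m' m)
parity-unique {suc (suc _)} (s≤s ())
parity-unique {_} {suc (suc _)} _ (s≤s ())

mirror-injective : ∀ {c c' M M'} → Sorted M → Sorted M' → mirror c M ≡ mirror c' M' → c ≡ c' × M ≡ M'
mirror-injective {c} {c'} {M} {M'} sM sM' e =
  block-injective (sorted-unique (block-sorted c) (block-sorted c') (λ a → proj₁ (split a))) ,
  sorted-unique sM sM' (λ a → proj₂ (split a))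
  where
  split : ∀ a → occ a (block c) ≡ occ a (block c') × occ a M ≡ occ a M'
  split a = parity-unique (occ-block a c) (occ-block a c')
    (trans (sym (occ-mirror a c M)) (trans (cong (occ a) e) (occ-mirror a c' M')))

maximum : List ℕ → ℕ
maximum = foldr _⊔_ 0

maximum-++ : ∀ xs ys → maximum (xs ++ ys) ≡ maximum xs ⊔ maximum ys
maximum-++ [] ys = refl
maximum-++ (x ∷ xs) ys = trans (cong (x ⊔_) (maximum-++ xs ys)) (sym (⊔-assoc x (maximum xs) (maximum ys)))

maximum-↭ : ∀ {xs ys} → xs ↭ ys → maximum xs ≡ maximum ys
maximum-↭ xs↭ys = foldr-commMonoid (setoid ℕ) ⊔-0-isCommutativeMonoid (↭⇒↭ₛ xs↭ys)

maximum-block : ∀ c → maximum (block c) ≡ c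
maximum-block zero = refl
maximum-block (suc c) = ⊔-identityʳ (suc c)

sum-block : ∀ c → sum (block c) ≡ c
sum-block zero = refl
sum-block (suc c) = +-identityʳ (suc c)

longest-multiset : ∀ X → longestZeroBlock X ≡ maximum (blockMultiset X)
longest-multiset X = sym (maximum-↭ (multisetOf-↭ (zeroBlocks X)))

zeros : ℕ → List Bool
zeros c = replicate c false

zeros-++ : ∀ c d R → zeros c ++ zeros d ++ R ≡ zeros (c + d) ++ R
zeros-++ zero d R = refl
zeros-++ (suc c) d R = cong (false ∷_) (zeros-++ c d R)

reverse-zeros : ∀ c → reverse (zeros c) ≡ zeros c
reverse-zeros zero = refl
reverse-zeros (suc c) = begin
  reverse (false ∷ zeros c)          ≡⟨ List.unfold-reverse false (zeros c) ⟩
  reverse (zeros c) ++ zeros 1       ≡⟨ cong (_++ zeros 1) (reverse-zeros c) ⟩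
  zeros c ++ zeros 1 ++ []           ≡⟨ zeros-++ c 1 [] ⟩
  zeros (c + 1) ++ []                ≡⟨ List.++-identityʳ (zeros (c + 1)) ⟩
  zeros (c + 1)                      ≡⟨ cong zeros (+-comm c 1) ⟩
  zeros (suc c)                      ∎
  where open ≡-Reasoning

reverse-around : ∀ (L : List Bool) b R → reverse (L ++ b ∷ R) ≡ reverse R ++ b ∷ reverse L
reverse-around L b R = begin
  reverse (L ++ b ∷ R)                ≡⟨ List.reverse-++ L (b ∷ R) ⟩
  reverse (b ∷ R) ++ reverse L        ≡⟨ cong (_++ reverse L) (List.unfold-reverse b R) ⟩
  (reverse R ++ b ∷ []) ++ reverse L  ≡⟨ List.++-assoc (reverse R) (b ∷ []) (reverse L) ⟩
  reverse R ++ b ∷ reverse L          ∎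
  where open ≡-Reasoning

-- A one closes the current run of zeros, so the blocks of L ++ 1 ∷ R are those of L, then those of R.
blocksAux-split : ∀ a L R → blocksAux a (L ++ true ∷ R) ≡ blocksAux a L ++ zeroBlocks R
blocksAux-split zero [] R = refl
blocksAux-split (suc a) [] R = refl
blocksAux-split zero (false ∷ L) R = blocksAux-split 1 L R
blocksAux-split (suc a) (false ∷ L) R = blocksAux-split (suc (suc a)) L R
blocksAux-split zero (true ∷ L) R = blocksAux-split zero L R
blocksAux-split (suc a) (true ∷ L) R = cong (suc a ∷_) (blocksAux-split zero L R)

blocksAux-zero : ∀ a xs → blocksAux a (false ∷ xs) ≡ blocksAux (suc a) xs
blocksAux-zero zero xs = refl
blocksAux-zero (suc a) xs = refl

blocksAux-zeros : ∀ a c R → blocksAux a (zeros c ++ R) ≡ blocksAux (c + a) R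
blocksAux-zeros a zero R = refl
blocksAux-zeros a (suc c) R = begin
  blocksAux a (false ∷ zeros c ++ R)   ≡⟨ blocksAux-zero a (zeros c ++ R) ⟩
  blocksAux (suc a) (zeros c ++ R)     ≡⟨ blocksAux-zeros (suc a) c R ⟩
  blocksAux (c + suc a) R              ≡⟨ cong (λ m → blocksAux m R) (+-suc c a) ⟩
  blocksAux (suc c + a) R              ∎
  where open ≡-Reasoning

zeroBlocks-zeros : ∀ c → zeroBlocks (zeros c) ≡ block c
zeroBlocks-zeros c = begin
  zeroBlocks (zeros c)        ≡⟨ cong zeroBlocks (sym (List.++-identityʳ (zeros c))) ⟩
  zeroBlocks (zeros c ++ [])  ≡⟨ blocksAux-zeros 0 c [] ⟩
  blocksAux (c + 0) []        ≡⟨ cong block (+-identityʳ c) ⟩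
  block c                     ∎
  where open ≡-Reasoning

zeroBlocks-run : ∀ c R → zeroBlocks (zeros c ++ true ∷ R) ≡ block c ++ zeroBlocks R
zeroBlocks-run c R = begin
  zeroBlocks (zeros c ++ true ∷ R)  ≡⟨ blocksAux-zeros 0 c (true ∷ R) ⟩
  blocksAux (c + 0) (true ∷ R)      ≡⟨ cong (λ m → blocksAux m (true ∷ R)) (+-identityʳ c) ⟩
  blocksAux c ([] ++ true ∷ R)      ≡⟨ blocksAux-split c [] R ⟩
  block c ++ zeroBlocks R           ∎
  where open ≡-Reasoning

data Runs : List Bool → Set where
  onlyZeros : ∀ c → Runs (zeros c)
  run : ∀ c Y → Runs Y → Runs (zeros c ++ true ∷ Y)

runs : ∀ X → Runs X
runs [] = onlyZeros 0
runs (true ∷ X) = run 0 X (runs X)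
runs (false ∷ X) with runs X
... | onlyZeros c = onlyZeros (suc c)
... | run c Y r = run (suc c) Y r

reverse-block : ∀ c → reverse (block c) ≡ block c
reverse-block zero = refl
reverse-block (suc c) = refl

zeroBlocks-reverse : ∀ X → zeroBlocks (reverse X) ≡ reverse (zeroBlocks X)
zeroBlocks-reverse X = go X (runs X)
  where
  open ≡-Reasoning
  go : ∀ X → Runs X → zeroBlocks (reverse X) ≡ reverse (zeroBlocks X)
  go _ (onlyZeros c) = begin
    zeroBlocks (reverse (zeros c))   ≡⟨ cong zeroBlocks (reverse-zeros c) ⟩
    zeroBlocks (zeros c)             ≡⟨ zeroBlocks-zeros c ⟩
    block c                          ≡⟨ sym (reverse-block c) ⟩
    reverse (block c)                ≡⟨ cong reverse (sym (zeroBlocks-zeros c)) ⟩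
    reverse (zeroBlocks (zeros c))   ∎
  go _ (run c Y r) = begin
    zeroBlocks (reverse (zeros c ++ true ∷ Y))           ≡⟨ cong zeroBlocks (reverse-around (zeros c) true Y) ⟩
    zeroBlocks (reverse Y ++ true ∷ reverse (zeros c))   ≡⟨ blocksAux-split 0 (reverse Y) (reverse (zeros c)) ⟩
    zeroBlocks (reverse Y) ++ zeroBlocks (reverse (zeros c))
      ≡⟨ cong₂ _++_ (go Y r) (trans (cong zeroBlocks (reverse-zeros c)) (zeroBlocks-zeros c)) ⟩
    reverse (zeroBlocks Y) ++ block c                    ≡⟨ cong (reverse (zeroBlocks Y) ++_) (sym (reverse-block c)) ⟩
    reverse (zeroBlocks Y) ++ reverse (block c)          ≡⟨ sym (List.reverse-++ (block c) (zeroBlocks Y)) ⟩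
    reverse (block c ++ zeroBlocks Y)                    ≡⟨ cong reverse (sym (zeroBlocks-run c Y)) ⟩
    reverse (zeroBlocks (zeros c ++ true ∷ Y))           ∎

-- Every zero lies in exactly one block (the open run of length a included).
sum-blocksAux : ∀ a X → sum (blocksAux a X) ≡ a + numZeros X
sum-blocksAux zero [] = refl
sum-blocksAux (suc a) [] = refl
sum-blocksAux zero (false ∷ X) = sum-blocksAux 1 X
sum-blocksAux (suc a) (false ∷ X) = trans (sum-blocksAux (suc (suc a)) X) (sym (+-suc (suc a) (numZeros X)))
sum-blocksAux zero (true ∷ X) = sum-blocksAux zero X
sum-blocksAux (suc a) (true ∷ X) = cong (suc a +_) (sum-blocksAux zero X)

numZeros-blocks : ∀ X → numZeros X ≡ sum (zeroBlocks X)
numZeros-blocks X = sym (sum-blocksAux 0 X)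

construct : ℕ → List Bool → List Bool
construct c Y = reverse Y ++ true ∷ zeros c ++ true ∷ Y

construct-palindrome : ∀ c Y → construct c Y ≡ reverse (construct c Y)
construct-palindrome c Y = sym (begin
  reverse (reverse Y ++ true ∷ zeros c ++ true ∷ Y)
    ≡⟨ reverse-around (reverse Y) true (zeros c ++ true ∷ Y) ⟩
  reverse (zeros c ++ true ∷ Y) ++ true ∷ reverse (reverse Y)
    ≡⟨ cong₂ (λ L R → L ++ true ∷ R) (reverse-around (zeros c) true Y) (List.reverse-involutive Y) ⟩
  (reverse Y ++ true ∷ reverse (zeros c)) ++ true ∷ Y
    ≡⟨ List.++-assoc (reverse Y) (true ∷ reverse (zeros c)) (true ∷ Y) ⟩
  reverse Y ++ true ∷ reverse (zeros c) ++ true ∷ Y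
    ≡⟨ cong (λ Z → reverse Y ++ true ∷ Z ++ true ∷ Y) (reverse-zeros c) ⟩
  construct c Y ∎)
  where open ≡-Reasoning

length-construct : ∀ c Y → length (construct c Y) ≡ c + 2 * suc (length Y)
length-construct c Y = begin
  length (construct c Y)                            ≡⟨ length-++ (reverse Y) ⟩
  length (reverse Y) + suc (length (zeros c ++ true ∷ Y))
    ≡⟨ cong₂ (λ l m → l + suc m) (List.length-reverse Y) (length-++ (zeros c)) ⟩
  length Y + suc (length (zeros c) + suc (length Y)) ≡⟨ cong (λ m → length Y + suc (m + suc (length Y))) (List.length-replicate c) ⟩
  length Y + suc (c + suc (length Y))               ≡⟨ arithmetic (length Y) c ⟩
  c + 2 * suc (length Y)                            ∎
  where
  open ≡-Reasoning
  arithmetic : ∀ l c → l + suc (c + suc l) ≡ c + 2 * suc l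
  arithmetic = solve-∀

zeroBlocks-construct : ∀ c Y → zeroBlocks (construct c Y) ↭ block c ++ zeroBlocks Y ++ zeroBlocks Y
zeroBlocks-construct c Y = begin
  zeroBlocks (construct c Y)                           ≡⟨ blocksAux-split 0 (reverse Y) (zeros c ++ true ∷ Y) ⟩
  zeroBlocks (reverse Y) ++ zeroBlocks (zeros c ++ true ∷ Y)
    ≡⟨ cong₂ _++_ (zeroBlocks-reverse Y) (zeroBlocks-run c Y) ⟩
  reverse (zeroBlocks Y) ++ block c ++ zeroBlocks Y    ↭⟨ Perm.shifts (reverse (zeroBlocks Y)) (block c) ⟩
  block c ++ reverse (zeroBlocks Y) ++ zeroBlocks Y    ↭⟨ Perm.++⁺ˡ (block c) (Perm.++⁺ʳ (zeroBlocks Y) (Perm.↭-reverse (zeroBlocks Y))) ⟩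
  block c ++ zeroBlocks Y ++ zeroBlocks Y              ∎
  where open PermutationReasoning

numZeros-construct : ∀ c Y → numZeros (construct c Y) ≡ c + 2 * numZeros Y
numZeros-construct c Y = begin
  numZeros (construct c Y)                             ≡⟨ numZeros-blocks (construct c Y) ⟩
  sum (zeroBlocks (construct c Y))                     ≡⟨ sum-↭ (zeroBlocks-construct c Y) ⟩
  sum (block c ++ zeroBlocks Y ++ zeroBlocks Y)        ≡⟨ sum-++ (block c) (zeroBlocks Y ++ zeroBlocks Y) ⟩
  sum (block c) + sum (zeroBlocks Y ++ zeroBlocks Y)   ≡⟨ cong₂ _+_ (sum-block c) (sum-++ (zeroBlocks Y) (zeroBlocks Y)) ⟩
  c + (sum (zeroBlocks Y) + sum (zeroBlocks Y))        ≡⟨ cong (λ m → c + (m + m)) (sym (numZeros-blocks Y)) ⟩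
  c + (numZeros Y + numZeros Y)                        ≡⟨ cong (λ m → c + (numZeros Y + m)) (sym (+-identityʳ (numZeros Y))) ⟩
  c + 2 * numZeros Y                                   ∎
  where open ≡-Reasoning

longest-construct : ∀ c Y → longestZeroBlock (construct c Y) ≡ c ⊔ longestZeroBlock Y
longest-construct c Y = begin
  maximum (zeroBlocks (construct c Y))                          ≡⟨ maximum-↭ (zeroBlocks-construct c Y) ⟩
  maximum (block c ++ zeroBlocks Y ++ zeroBlocks Y)             ≡⟨ maximum-++ (block c) (zeroBlocks Y ++ zeroBlocks Y) ⟩
  maximum (block c) ⊔ maximum (zeroBlocks Y ++ zeroBlocks Y)    ≡⟨ cong₂ _⊔_ (maximum-block c) (maximum-++ (zeroBlocks Y) (zeroBlocks Y)) ⟩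
  c ⊔ (longestZeroBlock Y ⊔ longestZeroBlock Y)                 ≡⟨ cong (c ⊔_) (⊔-idem (longestZeroBlock Y)) ⟩
  c ⊔ longestZeroBlock Y                                        ∎
  where open ≡-Reasoning

blockMultiset-construct : ∀ c Y → blockMultiset (construct c Y) ≡ mirror c (blockMultiset Y)
blockMultiset-construct c Y = sorted-↭ (multisetOf-sorted (zeroBlocks (construct c Y))) (multisetOf-sorted (block c ++ blockMultiset Y ++ blockMultiset Y)) (begin
  multisetOf (zeroBlocks (construct c Y))            ↭⟨ multisetOf-↭ (zeroBlocks (construct c Y)) ⟩
  zeroBlocks (construct c Y)                         ↭⟨ zeroBlocks-construct c Y ⟩
  block c ++ zeroBlocks Y ++ zeroBlocks Y            ↭⟨ Perm.++⁺ˡ (block c) (Perm.++⁺ (M↭ Y) (M↭ Y)) ⟨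
  block c ++ blockMultiset Y ++ blockMultiset Y      ↭⟨ multisetOf-↭ (block c ++ blockMultiset Y ++ blockMultiset Y) ⟨
  mirror c (blockMultiset Y)                         ∎)
  where
  open PermutationReasoning
  M↭ : ∀ Y → blockMultiset Y ↭ zeroBlocks Y
  M↭ Y = multisetOf-↭ (zeroBlocks Y)

numZeros-++ : ∀ L R → numZeros (L ++ R) ≡ numZeros L + numZeros R
numZeros-++ [] R = refl
numZeros-++ (false ∷ L) R = cong suc (numZeros-++ L R)
numZeros-++ (true ∷ L) R = numZeros-++ L R

numZeros-reverse : ∀ X → numZeros (reverse X) ≡ numZeros X
numZeros-reverse X = begin
  numZeros (reverse X)           ≡⟨ numZeros-blocks (reverse X) ⟩
  sum (zeroBlocks (reverse X))   ≡⟨ cong sum (zeroBlocks-reverse X) ⟩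
  sum (reverse (zeroBlocks X))   ≡⟨ sum-↭ (Perm.↭-reverse (zeroBlocks X)) ⟩
  sum (zeroBlocks X)             ≡⟨ numZeros-blocks X ⟨
  numZeros X                     ∎
  where open ≡-Reasoning

numZeros-zeros : ∀ c → numZeros (zeros c) ≡ c
numZeros-zeros zero = refl
numZeros-zeros (suc c) = cong suc (numZeros-zeros c)

split-at : ∀ {A : Set} n (X : List A) → n ≤ length X → ∃₂ λ L R → length L ≡ n × X ≡ L ++ R
split-at n X n≤ = take n X , drop n X ,
  trans (List.length-take n X) (m≤n⇒m⊓n≡m n≤) , sym (List.take++drop≡id n X)

prefix-unique : ∀ {A : Set} (L L' : List A) {R R'} → length L ≡ length L' → L ++ R ≡ L' ++ R' → L ≡ L'
prefix-unique [] [] _ _ = refl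
prefix-unique (x ∷ L) (x' ∷ L') same-length e =
  cong₂ _∷_ (List.∷-injectiveˡ e) (prefix-unique L L' (suc-injective same-length) (List.∷-injectiveʳ e))

palindrome-halves : ∀ n r (X : List Bool) → length X ≡ n + (r + n) → X ≡ reverse X →
  ∃₂ λ W M → length W ≡ n × length M ≡ r × X ≡ reverse W ++ M ++ W
palindrome-halves n r X |X| palindrome with split-at n X (subst (n ≤_) (sym |X|) (m≤m+n n (r + n)))
... | L , R , |L| , refl with split-at r R (subst (r ≤_) (sym |R|) (m≤m+n r n))
  where
  |R| : length R ≡ r + n
  |R| = +-cancelˡ-≡ n _ _ (trans (cong (_+ length R) (sym |L|)) (trans (sym (length-++ L)) |X|))
...   | M , W , |M| , refl = W , M , |W| , |M| , cong (_++ M ++ W) L≡Wʳ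
  where
  |W| : length W ≡ n
  |W| = +-cancelˡ-≡ (n + r) _ _ (begin
    n + r + length W           ≡⟨ cong₂ (λ l m → l + m + length W) (sym |L|) (sym |M|) ⟩
    length L + length M + length W ≡⟨ +-assoc (length L) (length M) (length W) ⟩
    length L + (length M + length W) ≡⟨ cong (length L +_) (sym (length-++ M)) ⟩
    length L + length (M ++ W) ≡⟨ sym (length-++ L) ⟩
    length (L ++ M ++ W)       ≡⟨ |X| ⟩
    n + (r + n)                ≡⟨ sym (+-assoc n r n) ⟩
    n + r + n                  ∎)
    where open ≡-Reasoning
  L≡Wʳ : L ≡ reverse W
  L≡Wʳ = prefix-unique L (reverse W) (trans |L| (sym (trans (List.length-reverse W) |W|))) (begin
    L ++ M ++ W                          ≡⟨ palindrome ⟩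
    reverse (L ++ M ++ W)                ≡⟨ List.reverse-++ L (M ++ W) ⟩
    reverse (M ++ W) ++ reverse L        ≡⟨ cong (_++ reverse L) (List.reverse-++ M W) ⟩
    (reverse W ++ reverse M) ++ reverse L ≡⟨ List.++-assoc (reverse W) (reverse M) (reverse L) ⟩
    reverse W ++ reverse M ++ reverse L  ∎)
    where open ≡-Reasoning

numZeros-halves : ∀ W M → numZeros (reverse W ++ M ++ W) ≡ numZeros M + 2 * numZeros W
numZeros-halves W M = begin
  numZeros (reverse W ++ M ++ W)                      ≡⟨ numZeros-++ (reverse W) (M ++ W) ⟩
  numZeros (reverse W) + numZeros (M ++ W)            ≡⟨ cong₂ _+_ (numZeros-reverse W) (numZeros-++ M W) ⟩
  numZeros W + (numZeros M + numZeros W)              ≡⟨ arithmetic (numZeros W) (numZeros M) ⟩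
  numZeros M + 2 * numZeros W                         ∎
  where
  open ≡-Reasoning
  arithmetic : ∀ w m → w + (m + w) ≡ m + 2 * w
  arithmetic = solve-∀

middle-zeros : ∀ {e w a} (M : List Bool) → length M ≡ e → e ≤ 1 → numZeros M + 2 * w ≡ e + 2 * a → M ≡ zeros e
middle-zeros [] refl _ _ = refl
middle-zeros (false ∷ []) refl _ _ = refl
middle-zeros {w = w} {a} (true ∷ []) refl _ zM = contradiction zM (even≢odd w a)
middle-zeros (_ ∷ _ ∷ _) refl (s≤s ())

numZeros-half : ∀ {e a} W → numZeros (reverse W ++ zeros e ++ W) ≡ e + 2 * a → numZeros W ≡ a
numZeros-half {e} {a} W zX = *-cancelˡ-≡ (numZeros W) a 2 (+-cancelˡ-≡ e _ _ (begin
  e + 2 * numZeros W                        ≡⟨ cong (_+ 2 * numZeros W) (numZeros-zeros e) ⟨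
  numZeros (zeros e) + 2 * numZeros W       ≡⟨ numZeros-halves W (zeros e) ⟨
  numZeros (reverse W ++ zeros e ++ W)      ≡⟨ zX ⟩
  e + 2 * a                                 ∎))
  where open ≡-Reasoning

palindrome-centred : ∀ {e n a} X → e ≤ 1 → a < n → length X ≡ e + 2 * n → X ≡ reverse X → numZeros X ≡ e + 2 * a →
  ∃₂ λ i Y → X ≡ construct (e + 2 * i) Y × suc (i + length Y) ≡ n
palindrome-centred {e} {n} {a} X e≤1 a<n |X| palindrome zX
  with palindrome-halves n e X (trans |X| (arithmetic e n)) palindrome
  where
  arithmetic : ∀ e n → e + 2 * n ≡ n + (e + n)
  arithmetic = solve-∀
... | W , M , |W| , |M| , refl with middle-zeros {w = numZeros W} {a} M |M| e≤1 (trans (sym (numZeros-halves W M)) zX)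
...   | refl with runs W
...     | onlyZeros c = contradiction a<n (<-irrefl (trans (sym c≡a) (trans (sym (List.length-replicate c)) |W|)))
  where
  c≡a : c ≡ a
  c≡a = trans (sym (numZeros-zeros c)) (numZeros-half (zeros c) zX)
...     | run c Y _ = c , Y , shape , trans (sym (+-suc c (length Y))) (trans (cong (_+ suc (length Y)) (sym (List.length-replicate c)))
                                                                  (trans (sym (length-++ (zeros c))) |W|))
  where
  open ≡-Reasoning
  shape : reverse (zeros c ++ true ∷ Y) ++ zeros e ++ zeros c ++ true ∷ Y ≡ construct (e + 2 * c) Y
  shape = begin
    reverse (zeros c ++ true ∷ Y) ++ zeros e ++ zeros c ++ true ∷ Y
      ≡⟨ cong (_++ zeros e ++ zeros c ++ true ∷ Y) (reverse-around (zeros c) true Y) ⟩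
    (reverse Y ++ true ∷ reverse (zeros c)) ++ zeros e ++ zeros c ++ true ∷ Y
      ≡⟨ List.++-assoc (reverse Y) (true ∷ reverse (zeros c)) (zeros e ++ zeros c ++ true ∷ Y) ⟩
    reverse Y ++ true ∷ reverse (zeros c) ++ zeros e ++ zeros c ++ true ∷ Y
      ≡⟨ cong (λ Z → reverse Y ++ true ∷ Z ++ zeros e ++ zeros c ++ true ∷ Y) (reverse-zeros c) ⟩
    reverse Y ++ true ∷ zeros c ++ zeros e ++ zeros c ++ true ∷ Y
      ≡⟨ cong (λ Z → reverse Y ++ true ∷ zeros c ++ Z) (zeros-++ e c (true ∷ Y)) ⟩
    reverse Y ++ true ∷ zeros c ++ zeros (e + c) ++ true ∷ Y
      ≡⟨ cong (λ Z → reverse Y ++ true ∷ Z) (zeros-++ c (e + c) (true ∷ Y)) ⟩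
    reverse Y ++ true ∷ zeros (c + (e + c)) ++ true ∷ Y
      ≡⟨ cong (λ m → construct m Y) (arithmetic e c) ⟩
    construct (e + 2 * c) Y ∎
    where
    arithmetic : ∀ e c → c + (e + c) ≡ e + 2 * c
    arithmetic = solve-∀

allStrings-length : ∀ m {X} → X ∈ allStrings m → length X ≡ m
allStrings-length (suc m) X∈ with ∈-++⁻ (map (false ∷_) (allStrings m)) X∈
... | inj₁ p with ∈-map⁻ (false ∷_) p
...   | Y , Y∈ , refl = cong suc (allStrings-length m Y∈)
allStrings-length (suc m) X∈ | inj₂ p with ∈-map⁻ (true ∷_) p
...   | Y , Y∈ , refl = cong suc (allStrings-length m Y∈)
allStrings-length zero (here refl) = refl

allStrings-complete : ∀ X → X ∈ allStrings (length X)
allStrings-complete [] = here refl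
allStrings-complete (false ∷ X) = ∈-++⁺ˡ (∈-map⁺ (false ∷_) (allStrings-complete X))
allStrings-complete (true ∷ X) = ∈-++⁺ʳ (map (false ∷_) (allStrings (length X))) (∈-map⁺ (true ∷_) (allStrings-complete X))

∈-B⁻ : ∀ {m y j X} → X ∈ B m y j → length X ≡ m × numZeros X ≡ y × longestZeroBlock X ≡ j
∈-B⁻ {m} {y} {j} X∈ with ∈-filter⁻ (inB? y j) {xs = allStrings m} X∈
... | X∈all , zeros≡ , longest≡ = allStrings-length m X∈all , zeros≡ , longest≡

∈-B⁺ : ∀ {m y j X} → length X ≡ m → numZeros X ≡ y → longestZeroBlock X ≡ j → X ∈ B m y j
∈-B⁺ {y = y} {j} {X} refl zeros≡ longest≡ = ∈-filter⁺ (inB? y j) (allStrings-complete X) (zeros≡ , longest≡)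

∈-Bhat⁻ : ∀ {m y j X} → X ∈ Bhat m y j → X ∈ B m y j × X ≡ reverse X
∈-Bhat⁻ {m} {y} {j} = ∈-filter⁻ isPalindrome? {xs = B m y j}

∈-Bhat⁺ : ∀ {m y j X} → X ∈ B m y j → X ≡ reverse X → X ∈ Bhat m y j
∈-Bhat⁺ = ∈-filter⁺ isPalindrome?

classes : List (List Bool) → ℕ
classes L = numDistinct (map blockMultiset L)

P-classes : ∀ N y j → P N y j ≡ classes (B (N ∸ 1) y j)
P-classes zero y j = refl
P-classes (suc N) y j = refl

Separated : List (List Bool) → List (List Bool) → Set
Separated L L' = ∀ {X X'} → X ∈ L → X' ∈ L' → blockMultiset X ≢ blockMultiset X'

classes-cong : ∀ {L L'} → L ∼[ set ] L' → classes L ≡ classes L'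
classes-cong L∼L' = numDistinct-cong (Set.map-cong (λ _ → refl) L∼L')

classes-++ : ∀ L L' → Separated L L' → classes (L ++ L') ≡ classes L + classes L'
classes-++ L L' separated = trans (cong numDistinct (map-++ blockMultiset L L'))
  (numDistinct-++ (map blockMultiset L) (map blockMultiset L') disjoint)
  where
  disjoint : ∀ {z} → z ∈ map blockMultiset L → z ∉ map blockMultiset L'
  disjoint z∈ z∈' with ∈-map⁻ blockMultiset z∈ | ∈-map⁻ blockMultiset z∈'
  ... | X , X∈ , refl | X' , X'∈ , z≡ = separated X∈ X'∈ z≡

classes-construct : ∀ c L → classes (map (construct c) L) ≡ classes L
classes-construct c L = begin
  numDistinct (map blockMultiset (map (construct c) L))   ≡⟨ cong numDistinct (sym (map-∘ L)) ⟩
  numDistinct (map (blockMultiset ∘ construct c) L)       ≡⟨ cong numDistinct (map-cong (blockMultiset-construct c) L) ⟩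
  numDistinct (map (mirror c ∘ blockMultiset) L)          ≡⟨ cong numDistinct (map-∘ L) ⟩
  numDistinct (map (mirror c) (map blockMultiset L))      ≡⟨ numDistinct-map (mirror c) (map blockMultiset L) injective ⟩
  numDistinct (map blockMultiset L)                       ∎
  where
  open ≡-Reasoning
  sorted : ∀ {M} → M ∈ map blockMultiset L → Sorted M
  sorted M∈ with ∈-map⁻ blockMultiset M∈
  ... | X , _ , refl = multisetOf-sorted (zeroBlocks X)
  injective : ∀ {M M'} → M ∈ map blockMultiset L → M' ∈ map blockMultiset L → mirror c M ≡ mirror c M' → M ≡ M'
  injective M∈ M'∈ e = proj₂ (mirror-injective {c} {c} (sorted M∈) (sorted M'∈) e)

catTo : ∀ {A : Set} → ℕ → (ℕ → List A) → List A
catTo zero F = []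
catTo (suc n) F = catTo n F ++ F n

∈-catTo⁺ : ∀ {A : Set} {n F i} {x : A} → i < n → x ∈ F i → x ∈ catTo n F
∈-catTo⁺ {n = suc n} {F} i<1+n x∈ with m≤n⇒m<n∨m≡n (m<1+n⇒m≤n i<1+n)
... | inj₁ i<n = ∈-++⁺ˡ (∈-catTo⁺ i<n x∈)
... | inj₂ refl = ∈-++⁺ʳ (catTo n F) x∈

∈-catTo⁻ : ∀ {A : Set} n F {x : A} → x ∈ catTo n F → ∃ λ i → i < n × x ∈ F i
∈-catTo⁻ (suc n) F x∈ with ∈-++⁻ (catTo n F) x∈
... | inj₁ p = let i , i<n , q = ∈-catTo⁻ n F p in i , m<n⇒m<1+n i<n , q
... | inj₂ q = n , ≤-refl , q

classes-catTo : ∀ n F → (∀ {i i'} → i < i' → i' < n → Separated (F i) (F i')) →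
  classes (catTo n F) ≡ sumTo n (λ i → classes (F i))
classes-catTo zero F _ = refl
classes-catTo (suc n) F separated = begin
  classes (catTo n F ++ F n)         ≡⟨ classes-++ (catTo n F) (F n) earlier-separated ⟩
  classes (catTo n F) + classes (F n) ≡⟨ cong (_+ classes (F n)) (classes-catTo n F λ i<i' i'<n → separated i<i' (m<n⇒m<1+n i'<n)) ⟩
  sumTo n (λ i → classes (F i)) + classes (F n) ∎
  where
  open ≡-Reasoning
  earlier-separated : Separated (catTo n F) (F n)
  earlier-separated X∈ X'∈ with ∈-catTo⁻ n F X∈
  ... | i , i<n , X∈Fi = separated i<n ≤-refl X∈Fi X'∈

sumTo-cong : ∀ n {f g : ℕ → ℕ} → (∀ i → f i ≡ g i) → sumTo n f ≡ sumTo n g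
sumTo-cong zero _ = refl
sumTo-cong (suc n) f≗g = cong₂ _+_ (sumTo-cong n f≗g) (f≗g n)

construct-separated : ∀ {c c'} L L' → c ≢ c' → Separated (map (construct c) L) (map (construct c') L')
construct-separated {c} {c'} L L' c≢c' X∈ X'∈ same with ∈-map⁻ (construct c) X∈ | ∈-map⁻ (construct c') X'∈
... | Y , _ , refl | Y' , _ , refl = c≢c' (proj₁ (mirror-injective (multisetOf-sorted (zeroBlocks Y)) (multisetOf-sorted (zeroBlocks Y'))
  (trans (sym (blockMultiset-construct c Y)) (trans same (blockMultiset-construct c' Y')))))

construct-separated-halves : ∀ c {L L'} → Separated L L' → Separated (map (construct c) L) (map (construct c) L')
construct-separated-halves c separated X∈ X'∈ same with ∈-map⁻ (construct c) X∈ | ∈-map⁻ (construct c) X'∈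
... | Y , Y∈ , refl | Y' , Y'∈ , refl = separated Y∈ Y'∈ (proj₂ (mirror-injective {c} {c} (multisetOf-sorted (zeroBlocks Y)) (multisetOf-sorted (zeroBlocks Y'))
  (trans (sym (blockMultiset-construct c Y)) (trans same (blockMultiset-construct c Y')))))

longest-separated : ∀ {m y j m' y' j'} → j ≢ j' → Separated (B m y j) (B m' y' j')
longest-separated {m} {y} {j} {m'} {y'} {j'} j≢j' {X} {X'} X∈ X'∈ same = j≢j' (begin
  _                               ≡⟨ proj₂ (proj₂ (∈-B⁻ {m} {y} {j} X∈)) ⟨
  longestZeroBlock X              ≡⟨ longest-multiset X ⟩
  maximum (blockMultiset X)       ≡⟨ cong maximum same ⟩
  maximum (blockMultiset X')      ≡⟨ longest-multiset X' ⟨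
  longestZeroBlock X'             ≡⟨ proj₂ (proj₂ (∈-B⁻ {m'} {y'} {j'} X'∈)) ⟩
  _                               ∎)
  where open ≡-Reasoning

-- (e + 2i) + 2(n - i) = e + 2n for i ≤ n: a centre of e + 2i and two halves of n - i.
centre+halves : ∀ e {i n} → i ≤ n → e + 2 * i + 2 * (n ∸ i) ≡ e + 2 * n
centre+halves e {i} {n} i≤n = begin
  e + 2 * i + 2 * (n ∸ i)          ≡⟨ +-assoc e (2 * i) (2 * (n ∸ i)) ⟩
  e + (2 * i + 2 * (n ∸ i))        ≡⟨ cong (λ m → e + (2 * i + m)) (*-distribˡ-∸ 2 n i) ⟩
  e + (2 * i + (2 * n ∸ 2 * i))    ≡⟨ cong (e +_) (m+[n∸m]≡n (*-monoʳ-≤ 2 i≤n)) ⟩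
  e + 2 * n                        ∎
  where open ≡-Reasoning

centre+halves⁻¹ : ∀ e {i h n} → e + 2 * i + 2 * h ≡ e + 2 * n → h ≡ n ∸ i
centre+halves⁻¹ e {i} {h} {n} total = begin
  h                ≡⟨ m+n∸m≡n i h ⟨
  i + h ∸ i        ≡⟨ cong (_∸ i) (*-cancelˡ-≡ (i + h) n 2 (begin
    2 * (i + h)          ≡⟨ *-distribˡ-+ 2 i h ⟩
    2 * i + 2 * h        ≡⟨ +-cancelˡ-≡ e _ _ (trans (sym (+-assoc e (2 * i) (2 * h))) total) ⟩
    2 * n                ∎)) ⟩
  n ∸ i            ∎
  where open ≡-Reasoning

suc-remaining : ∀ {i n} → i < n → suc (n ∸ i ∸ 1) ≡ n ∸ i
suc-remaining {i} {n} i<n = begin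
  suc (n ∸ i ∸ 1)      ≡⟨ cong suc (∸-+-assoc n i 1) ⟩
  suc (n ∸ (i + 1))    ≡⟨ cong (λ m → suc (n ∸ m)) (+-comm i 1) ⟩
  suc (n ∸ suc i)      ≡⟨ +-∸-assoc 1 i<n ⟨
  n ∸ i                ∎
  where open ≡-Reasoning

construct-∈-Bhat : ∀ e {n a i ℓ Y} → i < n → i ≤ a → Y ∈ B (n ∸ i ∸ 1) (a ∸ i) ℓ →
  construct (e + 2 * i) Y ∈ Bhat (e + 2 * n) (e + 2 * a) ((e + 2 * i) ⊔ ℓ)
construct-∈-Bhat e {n} {a} {i} {ℓ} {Y} i<n i≤a Y∈ with ∈-B⁻ {n ∸ i ∸ 1} {a ∸ i} {ℓ} Y∈
... | |Y| , zY , ℓY = ∈-Bhat⁺ {e + 2 * n} {e + 2 * a} (∈-B⁺ length≡ zeros≡ longest≡) (construct-palindrome (e + 2 * i) Y)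
  where
  open ≡-Reasoning
  length≡ : length (construct (e + 2 * i) Y) ≡ e + 2 * n
  length≡ = begin
    length (construct (e + 2 * i) Y)  ≡⟨ length-construct (e + 2 * i) Y ⟩
    e + 2 * i + 2 * suc (length Y)    ≡⟨ cong (λ l → e + 2 * i + 2 * suc l) |Y| ⟩
    e + 2 * i + 2 * suc (n ∸ i ∸ 1)   ≡⟨ cong (λ l → e + 2 * i + 2 * l) (suc-remaining i<n) ⟩
    e + 2 * i + 2 * (n ∸ i)           ≡⟨ centre+halves e (<⇒≤ i<n) ⟩
    e + 2 * n                         ∎
  zeros≡ : numZeros (construct (e + 2 * i) Y) ≡ e + 2 * a
  zeros≡ = begin
    numZeros (construct (e + 2 * i) Y) ≡⟨ numZeros-construct (e + 2 * i) Y ⟩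
    e + 2 * i + 2 * numZeros Y         ≡⟨ cong (λ z → e + 2 * i + 2 * z) zY ⟩
    e + 2 * i + 2 * (a ∸ i)            ≡⟨ centre+halves e i≤a ⟩
    e + 2 * a                          ∎
  longest≡ : longestZeroBlock (construct (e + 2 * i) Y) ≡ (e + 2 * i) ⊔ ℓ
  longest≡ = trans (longest-construct (e + 2 * i) Y) (cong ((e + 2 * i) ⊔_) ℓY)

Bhat-centred : ∀ {e n a k X} → e ≤ 1 → a < n → X ∈ Bhat (e + 2 * n) (e + 2 * a) k →
  ∃₂ λ i Y → X ≡ construct (e + 2 * i) Y × Y ∈ B (n ∸ i ∸ 1) (a ∸ i) (longestZeroBlock Y)
           × (e + 2 * i) ⊔ longestZeroBlock Y ≡ k
Bhat-centred {e} {n} {a} {k} {X} e≤1 a<n X∈ with ∈-Bhat⁻ {e + 2 * n} {e + 2 * a} {k} X∈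
... | X∈B , palindrome with ∈-B⁻ {e + 2 * n} {e + 2 * a} {k} X∈B
...   | |X| , zX , ℓX with palindrome-centred X e≤1 a<n |X| palindrome zX
...     | i , Y , refl , |Y|+i = i , Y , refl , ∈-B⁺ {n ∸ i ∸ 1} {a ∸ i} length≡ zeros≡ refl , trans (sym (longest-construct (e + 2 * i) Y)) ℓX
  where
  length≡ : length Y ≡ n ∸ i ∸ 1
  length≡ = begin
    length Y                  ≡⟨⟩
    suc (length Y) ∸ 1        ≡⟨ cong (_∸ 1) (m+n∸m≡n i (suc (length Y))) ⟨
    i + suc (length Y) ∸ i ∸ 1 ≡⟨ cong (λ m → m ∸ i ∸ 1) (trans (+-suc i (length Y)) |Y|+i) ⟩
    n ∸ i ∸ 1                 ∎
    where open ≡-Reasoning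
  zeros≡ : numZeros Y ≡ a ∸ i
  zeros≡ = centre+halves⁻¹ e {i} {numZeros Y} {a} (trans (sym (numZeros-construct (e + 2 * i) Y)) zX)

halve-< : ∀ e {i a} → e + 2 * i < e + 2 * a → i < a
halve-< e {i} {a} lt = *-cancelˡ-< 2 i a (+-cancelˡ-< e (2 * i) (2 * a) lt)

halve-≤ : ∀ e {i a} → e + 2 * i ≤ e + 2 * a → i ≤ a
halve-≤ e {i} {a} le = *-cancelˡ-≤ 2 (+-cancelˡ-≤ e (2 * i) (2 * a) le)

halve-≡ : ∀ e {i a} → e + 2 * i ≡ e + 2 * a → i ≡ a
halve-≡ e {i} {a} eq = *-cancelˡ-≡ i a 2 (+-cancelˡ-≡ e (2 * i) (2 * a) eq)

-- Whether a central run can be a longest block of length k: it must have length k = e + 2d,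
-- which fails exactly when k and e have different parities (flag true).
data CentreLength (e k d : ℕ) : Bool → Set where
  wrongParity : (∀ i → k ≢ e + 2 * i) → CentreLength e k d true
  rightParity : k ≡ e + 2 * d → CentreLength e k d false

-- N is the
-- number of central runs e + 2i shorter than k, and d, when k = e + 2d, indexes the central
-- run of length k.  The hypotheses a < n and k ≤ e + 2a ensure that every such palindrome
-- contains a one and that all centres fit into it.
module PalindromeCount {e n a k N d : ℕ} (e≤1 : e ≤ 1) (a<n : a < n) (k≤ : k ≤ e + 2 * a)
  (centres : ∀ i → i < N ⇔ e + 2 * i < k) where

  -- Palindromes whose central run e + 2i is shorter than k, so a half has longest block k.
  shortCentre : ℕ → List (List Bool)
  shortCentre i = map (construct (e + 2 * i)) (B (n ∸ i ∸ 1) (a ∸ i) k)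

  longCentre : ℕ → List (List Bool)
  longCentre j = map (construct k) (B (n ∸ d ∸ 1) (a ∸ d) j)

  longCentres : ∀ {b} → CentreLength e k d b → List (List Bool)
  longCentres (wrongParity _) = []
  longCentres (rightParity _) = catTo (suc k) longCentre

  long-∈ : ∀ {b} (w : CentreLength e k d b) {i j Y} → e + 2 * i ≡ k → j ≤ k → Y ∈ B (n ∸ i ∸ 1) (a ∸ i) j →
    construct (e + 2 * i) Y ∈ catTo N shortCentre ++ longCentres w
  long-∈ (wrongParity other) {i} centre≡k _ _ = contradiction (sym centre≡k) (other i)
  long-∈ (rightParity k≡) {i} centre≡k j≤k Y∈ with halve-≡ e {i} {d} (trans centre≡k k≡)
  ... | refl = ∈-++⁺ʳ (catTo N shortCentre) (∈-catTo⁺ (s≤s j≤k)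
    (subst (λ c → construct c _ ∈ longCentre _) (sym centre≡k) (∈-map⁺ (construct k) Y∈)))

  long-∈-Bhat : ∀ {b} (w : CentreLength e k d b) {X} → X ∈ longCentres w → X ∈ Bhat (e + 2 * n) (e + 2 * a) k
  long-∈-Bhat (rightParity k≡) X∈ with ∈-catTo⁻ (suc k) longCentre X∈
  ... | j , j<1+k , X∈j with ∈-map⁻ (construct k) X∈j
  ...   | Y , Y∈ , refl = subst₂ (λ c m → construct c Y ∈ Bhat (e + 2 * n) (e + 2 * a) m) (sym k≡)
      (trans (m≥n⇒m⊔n≡m (subst (j ≤_) k≡ (m<1+n⇒m≤n j<1+k))) (sym k≡))
      (construct-∈-Bhat e (≤-<-trans d≤a a<n) d≤a Y∈)
    where
    d≤a : d ≤ a
    d≤a = halve-≤ e (subst (_≤ e + 2 * a) k≡ k≤)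

  decomposition : ∀ {b} (w : CentreLength e k d b) →
    Bhat (e + 2 * n) (e + 2 * a) k ∼[ set ] catTo N shortCentre ++ longCentres w
  decomposition w = mk⇔ to from
    where
    to : ∀ {X} → X ∈ Bhat (e + 2 * n) (e + 2 * a) k → X ∈ catTo N shortCentre ++ longCentres w
    to X∈ with Bhat-centred e≤1 a<n X∈
    ... | i , Y , refl , Y∈ , ⊔≡k with e + 2 * i <? longestZeroBlock Y
    ...   | yes shorter = ∈-++⁺ˡ (∈-catTo⁺ (Equivalence.from (centres i) (subst (e + 2 * i <_) ℓ≡k shorter))
                                            (∈-map⁺ (construct (e + 2 * i)) (subst (λ j → Y ∈ B (n ∸ i ∸ 1) (a ∸ i) j) ℓ≡k Y∈)))
      where
      ℓ≡k : longestZeroBlock Y ≡ k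
      ℓ≡k = trans (sym (m≤n⇒m⊔n≡n (<⇒≤ shorter))) ⊔≡k
    ...   | no notShorter = long-∈ w {i} centre≡k (subst (longestZeroBlock Y ≤_) centre≡k (≮⇒≥ notShorter)) Y∈
      where
      centre≡k : e + 2 * i ≡ k
      centre≡k = trans (sym (m≥n⇒m⊔n≡m (≮⇒≥ notShorter))) ⊔≡k
    from : ∀ {X} → X ∈ catTo N shortCentre ++ longCentres w → X ∈ Bhat (e + 2 * n) (e + 2 * a) k
    from X∈ with ∈-++⁻ (catTo N shortCentre) X∈
    ... | inj₂ X∈long = long-∈-Bhat w X∈long
    ... | inj₁ X∈short with ∈-catTo⁻ N shortCentre X∈short
    ...   | i , i<N , X∈i with ∈-map⁻ (construct (e + 2 * i)) X∈i
    ...     | Y , Y∈ , refl = subst (λ m → construct (e + 2 * i) Y ∈ Bhat (e + 2 * n) (e + 2 * a) m)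
                                     (m≤n⇒m⊔n≡n (<⇒≤ shorter)) (construct-∈-Bhat e (<-trans i<a a<n) (<⇒≤ i<a) Y∈)
      where
      shorter : e + 2 * i < k
      shorter = Equivalence.to (centres i) i<N
      i<a : i < a
      i<a = halve-< e (<-≤-trans shorter k≤)

  separated : ∀ {b} (w : CentreLength e k d b) → Separated (catTo N shortCentre) (longCentres w)
  separated (rightParity _) X∈ X'∈ with ∈-catTo⁻ N shortCentre X∈ | ∈-catTo⁻ (suc k) longCentre X'∈
  ... | i , i<N , X∈i | j , _ , X'∈j =
    construct-separated _ _ (<⇒≢ (Equivalence.to (centres i) i<N)) X∈i X'∈j

  classes-short : classes (catTo N shortCentre) ≡ sumTo N (λ i → classes (B (n ∸ i ∸ 1) (a ∸ i) k))
  classes-short = trans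
    (classes-catTo N shortCentre (λ {i} {i'} i<i' _ → construct-separated _ _ (<⇒≢ i<i' ∘ halve-≡ e)))
    (sumTo-cong N (λ i → classes-construct (e + 2 * i) (B (n ∸ i ∸ 1) (a ∸ i) k)))

  classes-long : ∀ {b} (w : CentreLength e k d b) →
    classes (longCentres w) ≡ (if b then 0 else sumTo (suc k) (λ j → classes (B (n ∸ d ∸ 1) (a ∸ d) j)))
  classes-long (wrongParity _) = refl
  classes-long (rightParity _) = trans
    (classes-catTo (suc k) longCentre (λ j<j' _ → construct-separated-halves k (longest-separated {n ∸ d ∸ 1} {a ∸ d} {_} {n ∸ d ∸ 1} {a ∸ d} (<⇒≢ j<j'))))
    (sumTo-cong (suc k) (λ j → classes-construct k (B (n ∸ d ∸ 1) (a ∸ d) j)))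

  count : ∀ {b} → CentreLength e k d b →
    classes (Bhat (e + 2 * n) (e + 2 * a) k)
      ≡ sumTo N (λ i → classes (B (n ∸ i ∸ 1) (a ∸ i) k))
        + (if b then 0 else sumTo (suc k) (λ j → classes (B (n ∸ d ∸ 1) (a ∸ d) j)))
  count w = begin
    classes (Bhat (e + 2 * n) (e + 2 * a) k)                     ≡⟨ classes-cong (decomposition w) ⟩
    classes (catTo N shortCentre ++ longCentres w)               ≡⟨ classes-++ (catTo N shortCentre) (longCentres w) (separated w) ⟩
    classes (catTo N shortCentre) + classes (longCentres w)      ≡⟨ cong₂ _+_ classes-short (classes-long w) ⟩
    _                                                            ∎
    where open ≡-Reasoning

data Parity : ℕ → Set where
  even : ∀ d → Parity (2 * d)
  odd : ∀ d → Parity (1 + 2 * d)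

parity : ∀ m → Parity m
parity zero = even 0
parity (suc m) with parity m
... | even d = odd d
... | odd d = subst Parity (*-suc 2 d) (even (suc d))

even-mod : ∀ d → (2 * d) % 2 ≡ 0
even-mod d = trans (cong (_% 2) (*-comm 2 d)) (m*n%n≡0 d 2)

odd-mod : ∀ d → (1 + 2 * d) % 2 ≡ 1
odd-mod d = trans (cong (λ m → (1 + m) % 2) (*-comm 2 d)) ([m+kn]%n≡m%n 1 d 2)

half-even : ∀ d → ⌊ 2 * d /2⌋ ≡ d
half-even d = trans (cong (λ m → ⌊ d + m /2⌋) (+-identityʳ d)) (sym (n≡⌊n+n/2⌋ d))

half-odd : ∀ d → ⌊ 1 + 2 * d /2⌋ ≡ d
half-odd d = trans (cong (λ m → ⌈ d + m /2⌉) (+-identityʳ d)) (sym (n≡⌈n+n/2⌉ d))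

half-diff : ∀ a i → ⌊ 2 * a ∸ 2 * i /2⌋ ≡ a ∸ i
half-diff a i = trans (cong ⌊_/2⌋ (sym (*-distribˡ-∸ 2 a i))) (half-even (a ∸ i))

double≤⇔≤half : ∀ m k → 2 * m ≤ k ⇔ m ≤ ⌊ k /2⌋
double≤⇔≤half m k = mk⇔
  (λ 2m≤k → subst (_≤ ⌊ k /2⌋) (half-even m) (⌊n/2⌋-mono 2m≤k))
  (λ m≤k/2 → ≤-trans (*-monoʳ-≤ 2 m≤k/2) double-half≤)
  where
  double-half≤ : 2 * ⌊ k /2⌋ ≤ k
  double-half≤ = subst₂ _≤_ (cong (⌊ k /2⌋ +_) (sym (+-identityʳ ⌊ k /2⌋))) (⌊n/2⌋+⌈n/2⌉≡n k)
    (+-monoʳ-≤ ⌊ k /2⌋ (⌊n/2⌋≤⌈n/2⌉ k))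

odd-centres : ∀ k i → i < ⌊ k /2⌋ ⇔ 1 + 2 * i < k
odd-centres k i = mk⇔
  (λ i<k/2 → subst (_≤ k) (*-suc 2 i) (Equivalence.from (double≤⇔≤half (suc i) k) i<k/2))
  (λ lt → Equivalence.to (double≤⇔≤half (suc i) k) (subst (_≤ k) (sym (*-suc 2 i)) lt))

even-centres : ∀ {k} → 1 ≤ k → ∀ i → i < ⌊ k ∸ 1 /2⌋ + 1 ⇔ 2 * i < k
even-centres {suc k} _ i = mk⇔
  (λ i<N → s≤s (Equivalence.from (double≤⇔≤half i k) (m<1+n⇒m≤n (subst (i <_) (+-comm ⌊ k /2⌋ 1) i<N))))
  (λ 2i<k → subst (i <_) (+-comm 1 ⌊ k /2⌋) (s≤s (Equivalence.to (double≤⇔≤half i k) (m<1+n⇒m≤n 2i<k))))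

-- In part (1) the flag k % 2 ≡ᵇ 0 of the theorem says that k is even, so an odd centre cannot
-- be a longest block; in part (2) the flag k % 2 ≡ᵇ 1 says the same for even centres.
odd-centreLength : ∀ k → CentreLength 1 k ⌊ k /2⌋ (k % 2 ≡ᵇ 0)
odd-centreLength k with parity k
... | even d rewrite even-mod d = wrongParity (even≢odd d)
... | odd d rewrite odd-mod d = rightParity (cong (λ m → 1 + 2 * m) (sym (half-odd d)))

even-centreLength : ∀ k → CentreLength 0 k ⌊ k /2⌋ (k % 2 ≡ᵇ 1)
even-centreLength k with parity k
... | even d rewrite even-mod d = rightParity (cong (2 *_) (sym (half-even d)))
... | odd d rewrite odd-mod d = wrongParity (λ i eq → even≢odd i d (sym eq))

else-cong : ∀ {e k d b s t} → CentreLength e k d b → (k ≡ e + 2 * d → s ≡ t) →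
  (if b then 0 else s) ≡ (if b then 0 else t)
else-cong (wrongParity _) _ = refl
else-cong (rightParity k≡) s≡t = s≡t k≡

odd-long-term : ∀ {n a k d} → k ≡ 1 + 2 * d → d < n → ∀ j →
  P ⌊ 2 * n ∸ k + 1 /2⌋ ⌊ (1 + 2 * a) ∸ k /2⌋ j ≡ classes (B (n ∸ d ∸ 1) (a ∸ d) j)
odd-long-term {n} {a} {d = d} refl d<n j = trans (P-classes ⌊ 2 * n ∸ (1 + 2 * d) + 1 /2⌋ _ j)
  (cong₂ (λ N y → classes (B (N ∸ 1) y j)) (trans (cong ⌊_/2⌋ gap) (half-diff n d)) (half-diff a d))
  where
  gap : 2 * n ∸ (1 + 2 * d) + 1 ≡ 2 * n ∸ 2 * d
  gap = trans (+-comm _ 1) (sym (+-∸-assoc 1 (≤-trans (n≤1+n _) (subst (_≤ 2 * n) (*-suc 2 d) (*-monoʳ-≤ 2 d<n)))))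

even-long-term : ∀ {n a k d} → k ≡ 2 * d → ∀ j →
  P ⌊ 2 * n ∸ k /2⌋ ⌊ 2 * a ∸ k /2⌋ j ≡ classes (B (n ∸ d ∸ 1) (a ∸ d) j)
even-long-term {n} {a} {d = d} refl j = trans (P-classes ⌊ 2 * n ∸ 2 * d /2⌋ _ j)
  (cong₂ (λ N y → classes (B (N ∸ 1) y j)) (half-diff n d) (half-diff a d))

odd-case : ∀ n x k → x % 2 ≡ 1 → 4 ≤ x → x ≤ 2 * n → 3 ≤ k → k ≤ x ∸ 2 →
  Phat (2 * n + 2) x k
    ≡ sumTo ⌊ k /2⌋ (λ i → P (n ∸ i) ⌊ x ∸ 2 * i ∸ 1 /2⌋ k)
      + (if k % 2 ≡ᵇ 0 then 0 else sumTo (k + 1) (λ j → P ⌊ 2 * n ∸ k + 1 /2⌋ ⌊ x ∸ k /2⌋ j))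
odd-case n x k x-odd _ x≤2n _ k≤x-2 with parity x
... | even a = contradiction (trans (sym (even-mod a)) x-odd) 0≢1+n
... | odd a = begin
  Phat (2 * n + 2) (1 + 2 * a) k
    ≡⟨ cong (λ m → Phat m (1 + 2 * a) k) (+-comm (2 * n) 2) ⟩
  classes (Bhat (1 + 2 * n) (1 + 2 * a) k)
    ≡⟨ PalindromeCount.count {1} {n} {a} {k} {⌊ k /2⌋} {⌊ k /2⌋} (s≤s z≤n) a<n k≤x (odd-centres k) (odd-centreLength k) ⟩
  sumTo ⌊ k /2⌋ (λ i → classes (B (n ∸ i ∸ 1) (a ∸ i) k))
    + (if k % 2 ≡ᵇ 0 then 0 else sumTo (suc k) (λ j → classes (B (n ∸ ⌊ k /2⌋ ∸ 1) (a ∸ ⌊ k /2⌋) j)))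
    ≡⟨ cong₂ _+_ (sumTo-cong ⌊ k /2⌋ short) (else-cong (odd-centreLength k) long) ⟨
  sumTo ⌊ k /2⌋ (λ i → P (n ∸ i) ⌊ 1 + 2 * a ∸ 2 * i ∸ 1 /2⌋ k)
    + (if k % 2 ≡ᵇ 0 then 0 else sumTo (k + 1) (λ j → P ⌊ 2 * n ∸ k + 1 /2⌋ ⌊ 1 + 2 * a ∸ k /2⌋ j)) ∎
  where
  open ≡-Reasoning
  a<n : a < n
  a<n = halve-< 0 x≤2n
  k≤x : k ≤ 1 + 2 * a
  k≤x = ≤-trans k≤x-2 (m∸n≤m (1 + 2 * a) 2)
  short : ∀ i → P (n ∸ i) ⌊ 1 + 2 * a ∸ 2 * i ∸ 1 /2⌋ k ≡ classes (B (n ∸ i ∸ 1) (a ∸ i) k)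
  short i = trans (P-classes (n ∸ i) _ k) (cong (λ y → classes (B (n ∸ i ∸ 1) y k)) (begin
    ⌊ 1 + 2 * a ∸ 2 * i ∸ 1 /2⌋    ≡⟨ cong ⌊_/2⌋ (∸-+-assoc (1 + 2 * a) (2 * i) 1) ⟩
    ⌊ 1 + 2 * a ∸ (2 * i + 1) /2⌋  ≡⟨ cong (λ m → ⌊ 1 + 2 * a ∸ m /2⌋) (+-comm (2 * i) 1) ⟩
    ⌊ 2 * a ∸ 2 * i /2⌋            ≡⟨ half-diff a i ⟩
    a ∸ i                          ∎))
  long : k ≡ 1 + 2 * ⌊ k /2⌋ →
    sumTo (k + 1) (λ j → P ⌊ 2 * n ∸ k + 1 /2⌋ ⌊ 1 + 2 * a ∸ k /2⌋ j)
      ≡ sumTo (suc k) (λ j → classes (B (n ∸ ⌊ k /2⌋ ∸ 1) (a ∸ ⌊ k /2⌋) j))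
  long k≡ = trans (cong (λ m → sumTo m (λ j → P ⌊ 2 * n ∸ k + 1 /2⌋ ⌊ 1 + 2 * a ∸ k /2⌋ j)) (+-comm k 1))
    (sumTo-cong (suc k) (odd-long-term {n} {a} {k} {⌊ k /2⌋} k≡ d<n))
    where
    d<n : ⌊ k /2⌋ < n
    d<n = ≤-<-trans (halve-≤ 1 (subst (_≤ 1 + 2 * a) k≡ k≤x)) a<n

-- Part (2): x = 2a zeros in palindromes of even length 2n, the case e = 0 of PalindromeCount
-- (the central run may be empty).
even-case : ∀ n x k → x % 2 ≡ 0 → 4 ≤ x → x ≤ 2 * n ∸ 1 → 3 ≤ k → k ≤ x ∸ 2 →
  Phat (2 * n + 1) x k
    ≡ sumTo (⌊ k ∸ 1 /2⌋ + 1) (λ i → P (n ∸ i) ⌊ x ∸ 2 * i /2⌋ k)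
      + (if k % 2 ≡ᵇ 1 then 0 else sumTo (k + 1) (λ j → P ⌊ 2 * n ∸ k /2⌋ ⌊ x ∸ k /2⌋ j))
even-case n x k x-even 4≤x x≤2n-1 3≤k k≤x-2 with parity x
... | odd a = contradiction (trans (sym (odd-mod a)) x-even) 1+n≢0
... | even a = begin
  Phat (2 * n + 1) (2 * a) k
    ≡⟨ cong (λ m → Phat m (2 * a) k) (+-comm (2 * n) 1) ⟩
  classes (Bhat (2 * n) (2 * a) k)
    ≡⟨ PalindromeCount.count {0} {n} {a} {k} {⌊ k ∸ 1 /2⌋ + 1} {⌊ k /2⌋} z≤n a<n k≤x (even-centres (≤-trans (s≤s z≤n) 3≤k))
         (even-centreLength k) ⟩
  sumTo (⌊ k ∸ 1 /2⌋ + 1) (λ i → classes (B (n ∸ i ∸ 1) (a ∸ i) k))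
    + (if k % 2 ≡ᵇ 1 then 0 else sumTo (suc k) (λ j → classes (B (n ∸ ⌊ k /2⌋ ∸ 1) (a ∸ ⌊ k /2⌋) j)))
    ≡⟨ cong₂ _+_ (sumTo-cong (⌊ k ∸ 1 /2⌋ + 1) short) (else-cong (even-centreLength k) long) ⟨
  sumTo (⌊ k ∸ 1 /2⌋ + 1) (λ i → P (n ∸ i) ⌊ 2 * a ∸ 2 * i /2⌋ k)
    + (if k % 2 ≡ᵇ 1 then 0 else sumTo (k + 1) (λ j → P ⌊ 2 * n ∸ k /2⌋ ⌊ 2 * a ∸ k /2⌋ j)) ∎
  where
  open ≡-Reasoning
  a<n : a < n
  a<n = halve-< 0 (below-pred (≤-trans (s≤s z≤n) 4≤x) x≤2n-1)
    where
    below-pred : ∀ {m p} → 1 ≤ m → m ≤ p ∸ 1 → m < p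
    below-pred {p = suc p} _ m≤p = s≤s m≤p
    below-pred {p = zero} 1≤m m≤0 = contradiction (≤-trans 1≤m m≤0) λ ()
  k≤x : k ≤ 2 * a
  k≤x = ≤-trans k≤x-2 (m∸n≤m (2 * a) 2)
  short : ∀ i → P (n ∸ i) ⌊ 2 * a ∸ 2 * i /2⌋ k ≡ classes (B (n ∸ i ∸ 1) (a ∸ i) k)
  short i = trans (P-classes (n ∸ i) _ k) (cong (λ y → classes (B (n ∸ i ∸ 1) y k)) (half-diff a i))
  long : k ≡ 2 * ⌊ k /2⌋ →
    sumTo (k + 1) (λ j → P ⌊ 2 * n ∸ k /2⌋ ⌊ 2 * a ∸ k /2⌋ j)
      ≡ sumTo (suc k) (λ j → classes (B (n ∸ ⌊ k /2⌋ ∸ 1) (a ∸ ⌊ k /2⌋) j))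
  long k≡ = trans (cong (λ m → sumTo m (λ j → P ⌊ 2 * n ∸ k /2⌋ ⌊ 2 * a ∸ k /2⌋ j)) (+-comm k 1))
    (sumTo-cong (suc k) (even-long-term {n} {a} {k} {⌊ k /2⌋} k≡))

theorem5p9 : (n x k : ℕ) →
    (x % 2 ≡ 1 → 4 ≤ x → x ≤ 2 * n → 3 ≤ k → k ≤ x ∸ 2 →
      Phat (2 * n + 2) x k
        ≡ sumTo ⌊ k /2⌋ (λ i → P (n ∸ i) ⌊ x ∸ 2 * i ∸ 1 /2⌋ k)
          + (if k % 2 ≡ᵇ 0 then 0 else sumTo (k + 1) (λ j → P ⌊ 2 * n ∸ k + 1 /2⌋ ⌊ x ∸ k /2⌋ j)))
    ×
    (x % 2 ≡ 0 → 4 ≤ x → x ≤ 2 * n ∸ 1 → 3 ≤ k → k ≤ x ∸ 2 →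
      Phat (2 * n + 1) x k
        ≡ sumTo (⌊ k ∸ 1 /2⌋ + 1) (λ i → P (n ∸ i) ⌊ x ∸ 2 * i /2⌋ k)
          + (if k % 2 ≡ᵇ 1 then 0 else sumTo (k + 1) (λ j → P ⌊ 2 * n ∸ k /2⌋ ⌊ x ∸ k /2⌋ j)))
theorem5p9 n x k = odd-case n x k , even-case n x k
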